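{- There exist absolute constants $c, C > 0$ and $N \in \mathbb{N}$ such that for every connected undirected simple graph $G$ on $n \ge N$ vertices, the convergence time of the asynchronous maximum model on $G$ satisfies $$c\, n \log n \;\le\; \mathcal{T}(G) \;\le\; C\, n^2 .$$ That is, $\mathcal{T}(G) = \Omega(n\log n)$ and $\mathcal{T}(G) = \mathcal{O}(n^2)$ as $n\to\infty$.
   Context: Let $G=(V,E)$ be a finite simple graph with $n=|V|$ vertices and write $[n]=\{1,\dots,n\}$. A valuation is a function $f:V\to[n]$. The asynchronous maximum model is the following discrete-time random process on valuations: given the current valuation $f_t$, choose a vertex $v'\in V$ uniformly at random, independently of the past; set $f_{t+1}(v')=\max\{f_t(u): u\neq v',\ (v',u)\in E\}$ if $v'$ has at least one out-neighbour (for undirected graphs: neighbour), and $f_{t+1}(v')=f_t(v')$ otherwise; and $f_{t+1}(v)=f_t(v)$ for all $v\neq v'$. (The chosen vertex's own value is not included in the maximum.) Each such step is a round. The Markov chain of possibilities is the directed graph (loops allowed) whose vertices are all valuations $V\to[n]$, with an edge $f\to g$ whenever the one-round transition probability from $f$ to $g$ is positive; its absorbing components are the maximal strongly connected components having no edge leaving them. For a valuation $f$, let $Y_f$ be the number of rounds until the process started at $f_0=f$ first reaches a valuation lying in an absorbing component, and $T(G,f)=\mathbb{E}[Y_f]$. The convergence time is $\mathcal{T}(G)=\max_f T(G,f)$, the maximum over all valuations $f:V\to[n]$. $\log$ is the natural logarithm. -}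

module Defs where

open import Data.Nat using (ℕ; zero; suc; _+_; _*_; _^_; _≤ᵇ_)
open import Data.Bool using (Bool; true; false; if_then_else_; _∧_; _∨_; not)
open import Data.Fin using (Fin; toℕ)
import Data.Fin.Properties as FinP
open import Data.Vec using (Vec; []; _∷_; lookup; _[_]≔_)
import Data.Vec.Properties as VecP
open import Data.List using (List; []; _∷_; map; concatMap; foldr; allFin)
open import Data.Bool.ListAction using (all; any)
open import Data.Nat.ListAction using (sum)
open import Data.Maybe using (Maybe; just; nothing; maybe)
open import Relation.Nullary.Decidable using (⌊_⌋)
open import Relation.Binary.PropositionalEquality using (_≡_)

record Graph (n : ℕ) : Set where
  field
    adj        : Fin n → Fin n → Bool
    adj-sym    : ∀ u v → adj u v ≡ adj v u
    adj-irrefl : ∀ v → adj v v ≡ false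
open Graph public

data Walk {n : ℕ} (G : Graph n) : Fin n → Fin n → Set where
  here : ∀ {u} → Walk G u u
  step : ∀ {u w v} → adj G u w ≡ true → Walk G w v → Walk G u v

Connected : ∀ {n} → Graph n → Set
Connected {n} G = (u v : Fin n) → Walk G u v

-- valuations V → [n]; [n] is represented (order-preservingly) by Fin n
Valuation : ℕ → Set
Valuation n = Vec (Fin n) n

maxFin : ∀ {n} → Fin n → Fin n → Fin n
maxFin a b = if toℕ a ≤ᵇ toℕ b then b else a

nbrMax : ∀ {n} → Graph n → Valuation n → Fin n → Maybe (Fin n)
nbrMax {n} G f v = foldr stp nothing (allFin n)
  where
  stp : Fin n → Maybe (Fin n) → Maybe (Fin n)
  stp u acc = if adj G v u ∧ not ⌊ u FinP.≟ v ⌋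
              then just (maybe (maxFin (lookup f u)) (lookup f u) acc)
              else acc

update : ∀ {n} → Graph n → Valuation n → Fin n → Valuation n
update G f v = f [ v ]≔ maybe (λ x → x) (lookup f v) (nbrMax G f v)

eqVal : ∀ {n} → Valuation n → Valuation n → Bool
eqVal f g = ⌊ VecP.≡-dec FinP._≟_ f g ⌋

reachᵇ : ∀ {n} → Graph n → ℕ → Valuation n → Valuation n → Bool
reachᵇ G zero    f g = eqVal f g
reachᵇ {n} G (suc k) f g =
  reachᵇ G k f g ∨ any (λ v → reachᵇ G k (update G f v) g) (allFin n)

allVecs : ∀ {n} (m : ℕ) → List (Vec (Fin n) m)
allVecs zero    = [] ∷ []
allVecs {n} (suc m) = concatMap (λ x → map (x ∷_) (allVecs m)) (allFin n)

-- f lies in an absorbing component (a closed SCC) iff every valuation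
-- reachable from f can reach f back.  The chain has n ^ n states, so
-- reachability coincides with reachability within n ^ n steps.
inAbsorbingᵇ : ∀ {n} → Graph n → Valuation n → Bool
inAbsorbingᵇ {n} G f =
  all (λ g → not (reachᵇ G (n ^ n) f g) ∨ reachᵇ G (n ^ n) g f) (allVecs n)

-- min(Y_f, k) along a fixed sequence of k chosen vertices
hitTrunc : ∀ {n k} → Graph n → Valuation n → Vec (Fin n) k → ℕ
hitTrunc G f []      = 0
hitTrunc G f (v ∷ w) =
  if inAbsorbingᵇ G f then 0 else suc (hitTrunc G (update G f v) w)

-- truncSum G k f = n ^ k * E[min(Y_f, k)]  (sum over all n ^ k equally
-- likely choice sequences of length k)
truncSum : ∀ {n} → Graph n → ℕ → Valuation n → ℕ
truncSum G k f = sum (map (hitTrunc G f) (allVecs k))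

-- Upper bound.  Call a vertex good if it carries the global maximum and has a neighbour
-- carrying the same value.  No round destroys a good vertex, and while the valuation is not
-- constant, connectivity yields an edge from a maximal vertex to a non-maximal vertex d, and
-- choosing d makes d good.  So the number of good vertices never decreases and grows with
-- probability at least 1/n per round, which bounds the expected absorption time by n · n.
-- The absorbing valuations are exactly the constant ones: those are fixed by every round,
-- and every valuation reaches one of them.
--
-- Lower bound.  Start from the valuation v ↦ v.  A vertex keeps its own value until it is
-- chosen, so the number q of such vertices drops by at most one per round, and only when one
-- of them is chosen (probability q/n), while absorption forces q ≤ 1.  Hence the
-- coupon-collector potential H(q) = Σ_{2 ≤ j ≤ q} ⌊n/j⌋ drops by at most 1 per round in
-- expectation.  Stopping at horizon k, n^k · H(n) is at most the truncated time sum T plus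
-- the potential R left after k rounds, and R is carried only by runs not yet absorbed, whose
-- hitting time is k, so k · R ≤ H(n) · T.  Taking k = H(n) + 1 gives 2 T ≥ n^k · H(n), and
-- grouping H(n) in dyadic blocks gives 4 · H(n) ≥ n · ⌊log₂ n⌋.

{-# OPTIONS --safe #-}
module Submission where

open import Defs
open import Data.Nat using (ℕ; _*_; _^_; _≤_)
open import Data.Nat.Logarithm using (⌊log₂_⌋)
open import Data.Product using (Σ; _×_; ∃-syntax)

open import Algebra.Properties.CommutativeSemigroup using (interchange; xy∙z≈y∙xz)
open import Data.Bool using (true; false; if_then_else_; _∧_; _∨_; not; T)
open import Data.Bool.Properties using (T-∨; T?)
import Data.Bool.Properties as Bool
open import Data.Fin using (Fin; toℕ) renaming (_≤_ to _≤ᶠ_)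
import Data.Fin.Properties as Fin
open import Data.List using (List; []; _∷_; map; concatMap; length; _++_; foldr; allFin)
open import Data.List.Extrema.Nat using (argmax; f[xs]≤f[argmax])
open import Data.List.Membership.Propositional using (_∈_; lose)
open import Data.List.Membership.Propositional.Properties using (∈-allFin; ∈-map⁺; ∈-concatMap⁺)
open import Data.List.Properties using (length-tabulate)
open import Data.List.Relation.Unary.All as All using (All; []; _∷_)
open import Data.List.Relation.Unary.All.Properties using (all⁺; all⁻)
open import Data.List.Relation.Unary.AllPairs using ([]; _∷_)
open import Data.List.Relation.Unary.Any using (here; there; satisfied)
open import Data.List.Relation.Unary.Any.Properties using (any⁺; any⁻)
open import Data.List.Relation.Unary.Unique.Propositional using (Unique)
open import Data.List.Relation.Unary.Unique.Propositional.Properties using (allFin⁺)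
open import Data.Maybe using (Maybe; just; nothing; maybe)
open import Data.Maybe.Properties using (just-injective)
open import Data.Nat using (zero; suc; _+_; _∸_; _<_; _≤ᵇ_; _≤′_; ≤′-refl; ≤′-step; z≤n; s≤s; ⌊_/2⌋; ⌈_/2⌉)
open import Data.Nat.DivMod using (_/_; _%_; m/n*n≤m; /-monoʳ-≤; m≡m%n+[m/n]*n; m%n<n; m≥n⇒m/n>0)
open import Data.Nat.Induction using (<-wellFounded)
open import Data.Nat.ListAction using (sum)
open import Data.Nat.Logarithm.Core using (⌊log2⌋)
open import Data.Nat.Properties
open import Data.Nat.Tactic.RingSolver using (solve-∀)
open import Data.Product using (_,_; proj₁; proj₂)
open import Data.Sum using (_⊎_; inj₁; inj₂; [_,_])
open import Data.Vec using (Vec; []; _∷_; lookup; _[_]≔_)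
import Data.Vec as Vec
open import Data.Vec.Properties using (lookup∘update; lookup∘update′; []≔-lookup; lookup-allFin)
open import Function using (_∘_; id)
open import Function.Bundles using (Equivalence)
open import Induction.WellFounded using (Acc; acc)
open import Level using (0ℓ)
open import Relation.Binary.PropositionalEquality hiding ([_])
open import Relation.Nullary using (Dec; yes; no; ¬_; contradiction)
open import Relation.Nullary.Decidable using (⌊_⌋; _×-dec_; toWitness; fromWitness)
open import Relation.Nullary.Reflects using (ofʸ; ofⁿ)
open import Relation.Unary using (Pred; Decidable)

∑ : {A : Set} → List A → (A → ℕ) → ℕ
∑ xs g = sum (map g xs)

module _ {A : Set} where

  ∑-cong : (xs : List A) {g h : A → ℕ} → (∀ x → g x ≡ h x) → ∑ xs g ≡ ∑ xs h
  ∑-cong []       g≡h = refl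
  ∑-cong (x ∷ xs) g≡h = cong₂ _+_ (g≡h x) (∑-cong xs g≡h)

  ∑-mono-≤ : (xs : List A) {g h : A → ℕ} → (∀ x → g x ≤ h x) → ∑ xs g ≤ ∑ xs h
  ∑-mono-≤ []       g≤h = z≤n
  ∑-mono-≤ (x ∷ xs) g≤h = +-mono-≤ (g≤h x) (∑-mono-≤ xs g≤h)

  ∑-+ : (xs : List A) (g h : A → ℕ) → ∑ xs (λ x → g x + h x) ≡ ∑ xs g + ∑ xs h
  ∑-+ []       g h = refl
  ∑-+ (x ∷ xs) g h = begin
    g x + h x + ∑ xs (λ x → g x + h x) ≡⟨ cong (g x + h x +_) (∑-+ xs g h) ⟩
    g x + h x + (∑ xs g + ∑ xs h)      ≡⟨ interchange +-commutativeSemigroup (g x) (h x) (∑ xs g) (∑ xs h) ⟩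
    g x + ∑ xs g + (h x + ∑ xs h)      ∎
    where open ≡-Reasoning

  ∑-*ˡ : (xs : List A) (c : ℕ) (g : A → ℕ) → ∑ xs (λ x → c * g x) ≡ c * ∑ xs g
  ∑-*ˡ []       c g = sym (*-zeroʳ c)
  ∑-*ˡ (x ∷ xs) c g = trans (cong (c * g x +_) (∑-*ˡ xs c g)) (sym (*-distribˡ-+ c (g x) (∑ xs g)))

  ∑-*ʳ : (xs : List A) (c : ℕ) (g : A → ℕ) → ∑ xs (λ x → g x * c) ≡ ∑ xs g * c
  ∑-*ʳ []       c g = refl
  ∑-*ʳ (x ∷ xs) c g = trans (cong (g x * c +_) (∑-*ʳ xs c g)) (sym (*-distribʳ-+ c (g x) (∑ xs g)))

  ∑-const : (xs : List A) (c : ℕ) → ∑ xs (λ _ → c) ≡ length xs * c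
  ∑-const []       c = refl
  ∑-const (x ∷ xs) c = cong (c +_) (∑-const xs c)

  ∑-++ : (xs ys : List A) (g : A → ℕ) → ∑ (xs ++ ys) g ≡ ∑ xs g + ∑ ys g
  ∑-++ []       ys g = refl
  ∑-++ (x ∷ xs) ys g = trans (cong (g x +_) (∑-++ xs ys g)) (sym (+-assoc (g x) (∑ xs g) (∑ ys g)))

  ∑+slack≤length* : (xs : List A) (g : A → ℕ) {b d : ℕ} {x₀ : A} → x₀ ∈ xs →
                (∀ x → g x ≤ b) → g x₀ + d ≤ b → ∑ xs g + d ≤ length xs * b
  ∑+slack≤length* (x ∷ xs) g {b} {d} (here refl) g≤b gx₀+d≤b = begin
    g x + ∑ xs g + d   ≡⟨ +-assoc (g x) (∑ xs g) d ⟩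
    g x + (∑ xs g + d) ≡⟨ cong (g x +_) (+-comm (∑ xs g) d) ⟩
    g x + (d + ∑ xs g) ≡⟨ +-assoc (g x) d (∑ xs g) ⟨
    g x + d + ∑ xs g   ≤⟨ +-mono-≤ gx₀+d≤b (∑-mono-≤ xs g≤b) ⟩
    b + ∑ xs (λ _ → b) ≡⟨ cong (b +_) (∑-const xs b) ⟩
    b + length xs * b  ∎
    where open ≤-Reasoning
  ∑+slack≤length* (x ∷ xs) g {b} {d} (there x₀∈xs) g≤b gx₀+d≤b = begin
    g x + ∑ xs g + d   ≡⟨ +-assoc (g x) (∑ xs g) d ⟩
    g x + (∑ xs g + d) ≤⟨ +-mono-≤ (g≤b x) (∑+slack≤length* xs g x₀∈xs g≤b gx₀+d≤b) ⟩
    b + length xs * b  ∎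
    where open ≤-Reasoning

∑-concatMap : {A B : Set} (xs : List A) (F : A → List B) (g : B → ℕ) →
              ∑ (concatMap F xs) g ≡ ∑ xs (λ x → ∑ (F x) g)
∑-concatMap []       F g = refl
∑-concatMap (x ∷ xs) F g = trans (∑-++ (F x) (concatMap F xs) g) (cong (∑ (F x) g +_) (∑-concatMap xs F g))

∑-map : {A B : Set} (xs : List A) (h : A → B) (g : B → ℕ) → ∑ (map h xs) g ≡ ∑ xs (λ x → g (h x))
∑-map []       h g = refl
∑-map (x ∷ xs) h g = cong (g (h x) +_) (∑-map xs h g)

ind : {P : Set} → Dec P → ℕ
ind (yes _) = 1
ind (no  _) = 0

count : {A : Set} {P : Pred A 0ℓ} → List A → Decidable P → ℕ
count xs P? = ∑ xs (λ x → ind (P? x))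

module _ {A : Set} {P : Pred A 0ℓ} where

  count-≤-length : (xs : List A) (P? : Decidable P) → count xs P? ≤ length xs
  count-≤-length []       P? = z≤n
  count-≤-length (x ∷ xs) P? = +-mono-≤ (ind≤1 (P? x)) (count-≤-length xs P?)
    where
    ind≤1 : ∀ {x} (p : Dec (P x)) → ind p ≤ 1
    ind≤1 (yes _) = ≤-refl
    ind≤1 (no  _) = z≤n

  count-all : (xs : List A) (P? : Decidable P) → (∀ x → P x) → count xs P? ≡ length xs
  count-all []       P? all-P = refl
  count-all (x ∷ xs) P? all-P with P? x
  ... | yes _  = cong suc (count-all xs P? all-P)
  ... | no ¬px = contradiction (all-P x) ¬px

  count-none : (xs : List A) (P? : Decidable P) → All (λ x → ¬ P x) xs → count xs P? ≡ 0
  count-none []       P? []           = refl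
  count-none (x ∷ xs) P? (¬px ∷ ¬pxs) with P? x
  ... | yes px = contradiction px ¬px
  ... | no  _  = count-none xs P? ¬pxs

  count-unique : (xs : List A) (P? : Decidable P) → Unique xs →
                 (∀ {x y} → P x → P y → x ≡ y) → count xs P? ≤ 1
  count-unique []       P? []             P-unique = z≤n
  count-unique (x ∷ xs) P? (x∉xs ∷ unique) P-unique with P? x
  ... | no  _  = count-unique xs P? unique P-unique
  ... | yes px = s≤s (≤-reflexive (count-none xs P? (All.map (λ x≢y py → x≢y (P-unique px py)) x∉xs)))

module _ {A : Set} {P Q : Pred A 0ℓ} where

  ind-mono : ∀ {x y} → (P x → Q y) → (p : Dec (P x)) (q : Dec (Q y)) → ind p ≤ ind q
  ind-mono P⇒Q (yes px) (yes _)  = ≤-refl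
  ind-mono P⇒Q (yes px) (no ¬qy) = contradiction (P⇒Q px) ¬qy
  ind-mono P⇒Q (no  _)  _        = z≤n

  count-mono : (xs : List A) (P? : Decidable P) (Q? : Decidable Q) →
               (∀ {x} → P x → Q x) → count xs P? ≤ count xs Q?
  count-mono xs P? Q? P⊆Q = ∑-mono-≤ xs λ x → ind-mono P⊆Q (P? x) (Q? x)

  count-mono-< : (xs : List A) (P? : Decidable P) (Q? : Decidable Q) →
                 (∀ {x} → P x → Q x) → ∀ {x₀} → x₀ ∈ xs → Q x₀ → ¬ P x₀ → count xs P? < count xs Q?
  count-mono-< (x ∷ xs) P? Q? P⊆Q (here refl) qx ¬px with P? x | Q? x
  ... | yes px | _      = contradiction px ¬px
  ... | no  _  | yes _  = s≤s (count-mono xs P? Q? P⊆Q)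
  ... | no  _  | no ¬qx = contradiction qx ¬qx
  count-mono-< (x ∷ xs) P? Q? P⊆Q (there x₀∈xs) qx ¬px =
    +-mono-≤-< (ind-mono P⊆Q (P? x) (Q? x)) (count-mono-< xs P? Q? P⊆Q x₀∈xs qx ¬px)

module _ {A : Set} {P Q R : Pred A 0ℓ} where

  count-≤-+ : (xs : List A) (P? : Decidable P) (Q? : Decidable Q) (R? : Decidable R) →
              (∀ {x} → P x → Q x ⊎ R x) → count xs P? ≤ count xs Q? + count xs R?
  count-≤-+ xs P? Q? R? P⊆Q∪R = begin
    count xs P?                            ≤⟨ ∑-mono-≤ xs (λ x → ind-≤-+ (P? x) (Q? x) (R? x)) ⟩
    ∑ xs (λ x → ind (Q? x) + ind (R? x))   ≡⟨ ∑-+ xs _ _ ⟩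
    count xs Q? + count xs R?              ∎
    where
    open ≤-Reasoning
    ind-≤-+ : ∀ {x} (p : Dec (P x)) (q : Dec (Q x)) (r : Dec (R x)) → ind p ≤ ind q + ind r
    ind-≤-+ (no  _)  _       _      = z≤n
    ind-≤-+ (yes px) (yes _) _      = s≤s z≤n
    ind-≤-+ (yes px) (no ¬q) (yes _) = s≤s z≤n
    ind-≤-+ (yes px) (no ¬q) (no ¬r) = contradiction (P⊆Q∪R px) [ ¬q , ¬r ]

length-allFin : ∀ n → length (allFin n) ≡ n
length-allFin n = length-tabulate id

T-not-∨⁺ : ∀ {a b} → (T a → T b) → T (not a ∨ b)
T-not-∨⁺ {true}  a⇒b = a⇒b _
T-not-∨⁺ {false} a⇒b = _

T-not-∨⁻ : ∀ {a b} → T (not a ∨ b) → T a → T b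
T-not-∨⁻ {true} t _ = t

maxFin-≥ˡ : ∀ {n} (a b : Fin n) → a ≤ᶠ maxFin a b
maxFin-≥ˡ a b with toℕ a ≤ᵇ toℕ b | ≤ᵇ-reflects-≤ (toℕ a) (toℕ b)
... | true  | ofʸ a≤b = a≤b
... | false | _       = ≤-refl

maxFin-≥ʳ : ∀ {n} (a b : Fin n) → b ≤ᶠ maxFin a b
maxFin-≥ʳ a b with toℕ a ≤ᵇ toℕ b | ≤ᵇ-reflects-≤ (toℕ a) (toℕ b)
... | true  | _       = ≤-refl
... | false | ofⁿ a≰b = <⇒≤ (≰⇒> a≰b)

maxFin-sel : ∀ {n} (a b : Fin n) → maxFin a b ≡ a ⊎ maxFin a b ≡ b
maxFin-sel a b with toℕ a ≤ᵇ toℕ b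
... | true  = inj₂ refl
... | false = inj₁ refl

module MaxModel {n : ℕ} (G : Graph n) where

  module _ (f : Valuation n) (v : Fin n) where

    private
      -- Definitionally the step of the fold in nbrMax, so the fold lemmas below are about nbrMax.
      visit : Fin n → Maybe (Fin n) → Maybe (Fin n)
      visit u best = if adj G v u ∧ not ⌊ u Fin.≟ v ⌋
                     then just (maybe (maxFin (lookup f u)) (lookup f u) best)
                     else best

      fold-attained : ∀ xs {m} → foldr visit nothing xs ≡ just m → ∃[ u ] m ≡ lookup f u
      fold-attained (x ∷ xs) eq with adj G v x ∧ not ⌊ x Fin.≟ v ⌋
      ... | false = fold-attained xs eq
      ... | true with foldr visit nothing xs in rest≡
      ...   | nothing = x , sym (just-injective eq)
      ...   | just m′ with maxFin-sel (lookup f x) m′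
      ...     | inj₁ max≡fx = x , trans (sym (just-injective eq)) max≡fx
      ...     | inj₂ max≡m′ = let (u , m′≡fu) = fold-attained xs rest≡ in
                              u , trans (sym (just-injective eq)) (trans max≡m′ m′≡fu)

      visit-grows : ∀ x {m} → ∃[ m′ ] visit x (just m) ≡ just m′ × m ≤ᶠ m′
      visit-grows x {m} with adj G v x ∧ not ⌊ x Fin.≟ v ⌋
      ... | true  = maxFin (lookup f x) m , refl , maxFin-≥ʳ (lookup f x) m
      ... | false = m , refl , ≤-refl

      fold-≥ : ∀ xs {u} → u ∈ xs → adj G v u ≡ true →
               ∃[ m ] foldr visit nothing xs ≡ just m × lookup f u ≤ᶠ m
      fold-≥ (x ∷ xs) (here refl) vx with x Fin.≟ v
      ... | yes refl = contradiction (trans (sym vx) (adj-irrefl G x)) λ ()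
      ... | no  _ rewrite vx with foldr visit nothing xs
      ...   | nothing = lookup f x , refl , ≤-refl
      ...   | just m  = maxFin (lookup f x) m , refl , maxFin-≥ˡ (lookup f x) m
      fold-≥ (x ∷ xs) (there u∈xs) vu with fold-≥ xs u∈xs vu
      ... | m , rest≡ , fu≤m rewrite rest≡ =
        let (m′ , visit≡ , m≤m′) = visit-grows x in m′ , visit≡ , ≤-trans fu≤m m≤m′

    nbrMax-attained : ∀ {m} → nbrMax G f v ≡ just m → ∃[ u ] m ≡ lookup f u
    nbrMax-attained = fold-attained (allFin n)

    nbrMax-≥ : ∀ {u} → adj G v u ≡ true → ∃[ m ] nbrMax G f v ≡ just m × lookup f u ≤ᶠ m
    nbrMax-≥ {u} = fold-≥ (allFin n) (∈-allFin u)

  newValue : Valuation n → Fin n → Fin n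
  newValue f v = maybe (λ x → x) (lookup f v) (nbrMax G f v)

  newValue-attained : ∀ f v → ∃[ u ] newValue f v ≡ lookup f u
  newValue-attained f v with nbrMax G f v in eq
  ... | nothing = v , refl
  ... | just m  = nbrMax-attained f v eq

  neighbour≤newValue : ∀ f {v u} → adj G v u ≡ true → lookup f u ≤ᶠ newValue f v
  neighbour≤newValue f {v} vu with nbrMax-≥ f v vu
  ... | m , eq , fu≤m rewrite eq = fu≤m

  update-attained : ∀ f v z → ∃[ u ] lookup (update G f v) z ≡ lookup f u
  update-attained f v z with z Fin.≟ v
  ... | yes refl = let (u , eq) = newValue-attained f z in u , trans (lookup∘update z f _) eq
  ... | no  z≢v  = z , lookup∘update′ z≢v f _

  Constant : Valuation n → Set
  Constant f = ∀ u w → lookup f u ≡ lookup f w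

  constant? : Decidable Constant
  constant? f = Fin.all? λ u → Fin.all? λ w → lookup f u Fin.≟ lookup f w

  update-constant : ∀ {f} v → Constant f → update G f v ≡ f
  update-constant {f} v const =
    let (u , eq) = newValue-attained f v in
    trans (cong (f [ v ]≔_) (trans eq (const u v))) ([]≔-lookup f v)

  Maximal : Valuation n → Fin n → Set
  Maximal f w = ∀ z → lookup f z ≤ᶠ lookup f w

  newValue-maximal : ∀ {f w v c} → Maximal f w → adj G v c ≡ true → lookup f c ≡ lookup f w →
                     newValue f v ≡ lookup f w
  newValue-maximal {f} {w} {v} max vc fc≡fw = Fin.≤-antisym
    (let (u , eq) = newValue-attained f v in subst (_≤ᶠ lookup f w) (sym eq) (max u))
    (subst (_≤ᶠ newValue f v) fc≡fw (neighbour≤newValue f vc))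

  maximal-update : ∀ {f w} v {z} → Maximal f w → lookup (update G f v) z ≡ lookup f w →
                   Maximal (update G f v) z
  maximal-update {f} {w} v {z} max f′z≡fw y =
    let (u , eq) = update-attained f v y in
    subst₂ _≤ᶠ_ (sym eq) (sym f′z≡fw) (max u)

  Good : Valuation n → Fin n → Set
  Good f v = Maximal f v × ∃[ u ] adj G v u ≡ true × lookup f u ≡ lookup f v

  good? : ∀ f → Decidable (Good f)
  good? f v = Fin.all? (λ z → lookup f z Fin.≤? lookup f v)
          ×-dec Fin.any? (λ u → (adj G v u Bool.≟ true) ×-dec (lookup f u Fin.≟ lookup f v))

  update-keeps-maximal : ∀ {f w y} v → Maximal f w → adj G w y ≡ true → lookup f y ≡ lookup f w →
                         lookup (update G f v) w ≡ lookup f w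
  update-keeps-maximal {f} {w} v max wy fy≡fw with v Fin.≟ w
  ... | yes refl = trans (lookup∘update v f _) (newValue-maximal {f} {w} max wy fy≡fw)
  ... | no  v≢w  = lookup∘update′ (v≢w ∘ sym) f _

  good-update : ∀ f v {u} → Good f u → Good (update G f v) u
  good-update f v {u} (max , u′ , uu′ , fu′≡fu) =
    maximal-update {f} {u} v max f′u≡fu , u′ , uu′ , trans f′u′≡fu′ (trans fu′≡fu (sym f′u≡fu))
    where
    f′u≡fu : lookup (update G f v) u ≡ lookup f u
    f′u≡fu = update-keeps-maximal {f} {u} v max uu′ fu′≡fu
    f′u′≡fu′ : lookup (update G f v) u′ ≡ lookup f u′
    f′u′≡fu′ = update-keeps-maximal {f} {u′} v (subst (λ m → ∀ z → lookup f z ≤ᶠ m) (sym fu′≡fu) max)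
                 (trans (adj-sym G u′ u) uu′) (sym fu′≡fu)

  walk-crossing : ∀ {P : Pred (Fin n) 0ℓ} → Decidable P → ∀ {a b} → Walk G a b → P a → ¬ P b →
                  ∃[ c ] ∃[ d ] adj G c d ≡ true × P c × ¬ P d
  walk-crossing P? here pa ¬pb = contradiction pa ¬pb
  walk-crossing P? {a} (step {w = w} aw rest) pa ¬pb with P? w
  ... | yes pw = walk-crossing P? rest pw ¬pb
  ... | no ¬pw = a , w , aw , pa , ¬pw

  good-progress : Connected G → ∀ {f} → ¬ Constant f → ∃[ v ] Good (update G f v) v × ¬ Good f v
  good-progress connected {f} nonconstant =
    progress-across (walk-crossing (λ c → lookup f c Fin.≟ lookup f w) (connected w x) refl fx≢fw)
    where
    u₀ : Fin n
    u₀ = proj₁ (Fin.¬∀⟶∃¬ n _ (λ u → Fin.all? λ w → lookup f u Fin.≟ lookup f w) nonconstant)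
    w : Fin n
    w = argmax (toℕ ∘ lookup f) u₀ (allFin n)
    max : Maximal f w
    max z = All.lookup (f[xs]≤f[argmax] u₀ (allFin n)) (∈-allFin z)
    not-all-max = Fin.¬∀⟶∃¬ n _ (λ x → lookup f x Fin.≟ lookup f w)
                    λ all≡fw → nonconstant λ u v → trans (all≡fw u) (sym (all≡fw v))
    x = proj₁ not-all-max
    fx≢fw = proj₂ not-all-max
    progress-across : (∃[ c ] ∃[ d ] adj G c d ≡ true × lookup f c ≡ lookup f w × lookup f d ≢ lookup f w) →
                      ∃[ v ] Good (update G f v) v × ¬ Good f v
    progress-across (c , d , cd , fc≡fw , fd≢fw) =
      d , (maximal-update {f} {w} d max f′d≡fw , c , dc , trans f′c≡fc (trans fc≡fw (sym f′d≡fw))) , ¬good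
      where
      dc : adj G d c ≡ true
      dc = trans (adj-sym G d c) cd
      f′d≡fw : lookup (update G f d) d ≡ lookup f w
      f′d≡fw = trans (lookup∘update d f _) (newValue-maximal {f} {w} max dc fc≡fw)
      f′c≡fc : lookup (update G f d) c ≡ lookup f c
      f′c≡fc = lookup∘update′ (λ c≡d → fd≢fw (subst (λ z → lookup f z ≡ lookup f w) c≡d fc≡fw)) f _
      ¬good : ¬ Good f d
      ¬good (max-d , _) = fd≢fw (Fin.≤-antisym (max d) (max-d w))

  goodCount : Valuation n → ℕ
  goodCount f = count (allFin n) (good? f)

  goodCount-≤ : ∀ f → goodCount f ≤ n
  goodCount-≤ f = ≤-trans (count-≤-length {P = Good f} (allFin n) (good? f)) (≤-reflexive (length-allFin n))

  goodCount-mono : ∀ f v → goodCount f ≤ goodCount (update G f v)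
  goodCount-mono f v = count-mono {P = Good f} (allFin n) (good? f) (good? (update G f v)) (good-update f v)

  goodCount-progress : Connected G → ∀ {f} → ¬ Constant f → ∃[ v ] goodCount f < goodCount (update G f v)
  goodCount-progress connected {f} nonconstant =
    let (v , good′ , ¬good) = good-progress connected {f} nonconstant in
    v , count-mono-< {P = Good f} (allFin n) (good? f) (good? (update G f v)) (good-update f v) (∈-allFin v) good′ ¬good

  Fixed? : ∀ f → Decidable {A = Fin n} (λ u → lookup f u ≡ u)
  Fixed? f u = lookup f u Fin.≟ u

  fixedCount : Valuation n → ℕ
  fixedCount f = count (allFin n) (Fixed? f)

  fixedCount-≤ : ∀ f → fixedCount f ≤ n
  fixedCount-≤ f = ≤-trans (count-≤-length (allFin n) (Fixed? f)) (≤-reflexive (length-allFin n))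

  fixedCount-constant : ∀ {f} → Constant f → fixedCount f ≤ 1
  fixedCount-constant {f} const =
    count-unique (allFin n) (Fixed? f) (allFin⁺ n) λ {u} {w} fu≡u fw≡w → trans (sym fu≡u) (trans (const u w) fw≡w)

  fixedCount-update : ∀ f x → fixedCount f ≤ fixedCount (update G f x) + 1
  fixedCount-update f x = begin
    fixedCount f                                                ≤⟨ count-≤-+ (allFin n) (Fixed? f) (Fixed? f′) (Fin._≟ x) still-fixed ⟩
    fixedCount f′ + count (allFin n) (Fin._≟ x)                 ≤⟨ +-monoʳ-≤ (fixedCount f′) (count-unique (allFin n) (Fin._≟ x) (allFin⁺ n) λ u≡x w≡x → trans u≡x (sym w≡x)) ⟩
    fixedCount f′ + 1                                           ∎
    where
    open ≤-Reasoning
    f′ = update G f x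
    still-fixed : ∀ {u} → lookup f u ≡ u → lookup f′ u ≡ u ⊎ u ≡ x
    still-fixed {u} fu≡u with u Fin.≟ x
    ... | yes u≡x = inj₂ u≡x
    ... | no  u≢x = inj₁ (trans (lookup∘update′ u≢x f _) fu≡u)

  fixedCount-update-unfixed : ∀ f x → lookup f x ≢ x → fixedCount f ≤ fixedCount (update G f x)
  fixedCount-update-unfixed f x fx≢x = count-mono (allFin n) (Fixed? f) (Fixed? (update G f x)) still-fixed
    where
    still-fixed : ∀ {u} → lookup f u ≡ u → lookup (update G f x) u ≡ u
    still-fixed {u} fu≡u with u Fin.≟ x
    ... | yes refl = contradiction fu≡u fx≢x
    ... | no  u≢x  = trans (lookup∘update′ u≢x f _) fu≡u

  fixedCount-identity : fixedCount (Vec.allFin n) ≡ n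
  fixedCount-identity = trans (count-all (allFin n) (Fixed? (Vec.allFin n)) lookup-allFin) (length-allFin n)

  goodCount-gap-< : Connected G → ∀ {f} → ¬ Constant f → ∃[ v ] n ∸ goodCount (update G f v) < n ∸ goodCount f
  goodCount-gap-< connected {f} nonconstant =
    let (v , lt) = goodCount-progress connected {f} nonconstant in
    v , ∸-monoʳ-< lt (goodCount-≤ (update G f v))

∈-allVecs : ∀ {n} m (w : Vec (Fin n) m) → w ∈ allVecs m
∈-allVecs zero    []      = here refl
∈-allVecs (suc m) (x ∷ w) = ∈-concatMap⁺ (λ y → map (y ∷_) (allVecs m)) (lose (∈-allFin x) (∈-map⁺ (x ∷_) (∈-allVecs m w)))

∑-allVecs-suc : ∀ {n} k (F : Vec (Fin n) (suc k) → ℕ) →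
                ∑ (allVecs (suc k)) F ≡ ∑ (allFin n) (λ v → ∑ (allVecs k) (λ w → F (v ∷ w)))
∑-allVecs-suc {n} k F = trans (∑-concatMap (allFin n) (λ v → map (v ∷_) (allVecs k)) F)
                              (∑-cong (allFin n) (λ v → ∑-map (allVecs k) (v ∷_) F))

∑-allVecs-1 : ∀ {n} k → ∑ (allVecs {n} k) (λ _ → 1) ≡ n ^ k
∑-allVecs-1         zero    = refl
∑-allVecs-1 {n} (suc k) = begin
  ∑ (allVecs {n} (suc k)) (λ _ → 1)                   ≡⟨ ∑-allVecs-suc {n} k (λ _ → 1) ⟩
  ∑ (allFin n) (λ _ → ∑ (allVecs {n} k) (λ _ → 1))    ≡⟨ ∑-cong (allFin n) (λ _ → ∑-allVecs-1 {n} k) ⟩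
  ∑ (allFin n) (λ _ → n ^ k)                          ≡⟨ ∑-const (allFin n) (n ^ k) ⟩
  length (allFin n) * n ^ k                           ≡⟨ cong (_* n ^ k) (length-allFin n) ⟩
  n * n ^ k                                           ∎
  where open ≡-Reasoning

n≤n^n : ∀ n → n ≤ n ^ n
n≤n^n zero    = z≤n
n≤n^n (suc m) = subst (_≤ suc m ^ suc m) (^-identityʳ (suc m)) (^-monoʳ-≤ (suc m) {1} {suc m} (s≤s z≤n))

module Absorption {n : ℕ} (G : Graph n) where

  open MaxModel G

  Reaches : ℕ → Valuation n → Valuation n → Set
  Reaches k f g = T (reachᵇ G k f g)

  reaches-refl : ∀ k f → Reaches k f f
  reaches-refl zero    f = fromWitness refl
  reaches-refl (suc k) f = Equivalence.from T-∨ (inj₁ (reaches-refl k f))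

  reaches-update : ∀ {k f g} v → Reaches k (update G f v) g → Reaches (suc k) f g
  reaches-update v r = Equivalence.from T-∨ (inj₂ (any⁺ _ (lose (∈-allFin v) r)))

  reaches-from-constant : ∀ k {f g} → Constant f → Reaches k f g → g ≡ f
  reaches-from-constant zero    const r = sym (toWitness r)
  reaches-from-constant (suc k) {f} const r with Equivalence.to T-∨ r
  ... | inj₁ r′  = reaches-from-constant k const r′
  ... | inj₂ any with satisfied (any⁻ _ (allFin n) any)
  ...   | v , r′ = reaches-from-constant k const (subst (λ f′ → Reaches k f′ _) (update-constant v const) r′)

  constant⇒absorbed : ∀ {f} → Constant f → T (inAbsorbingᵇ G f)
  constant⇒absorbed {f} const = all⁻ _ (All.universal (λ g → T-not-∨⁺ (reaches-back g)) (allVecs n))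
    where
    reaches-back : ∀ g → Reaches (n ^ n) f g → Reaches (n ^ n) g f
    reaches-back g f↝g = subst (λ h → Reaches (n ^ n) h f) (sym (reaches-from-constant (n ^ n) const f↝g)) (reaches-refl (n ^ n) f)

  reaches-constant : Connected G → ∀ k f → n ∸ goodCount f ≤ k → ∃[ g ] Constant g × Reaches k f g
  reaches-constant connected k f = by-cases (constant? f) k
    where
    descend : (∃[ v ] n ∸ goodCount (update G f v) < n ∸ goodCount f) →
              ∀ k → n ∸ goodCount f ≤ k → ∃[ g ] Constant g × Reaches k f g
    descend (v , gap′<gap) zero    gap≤0   = contradiction (≤-trans gap′<gap gap≤0) λ ()
    descend (v , gap′<gap) (suc k) gap≤1+k =
      let (g , const , r) = reaches-constant connected k (update G f v) (≤-pred (≤-trans gap′<gap gap≤1+k)) in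
      g , const , reaches-update {k} v r
    by-cases : Dec (Constant f) → ∀ k → n ∸ goodCount f ≤ k → ∃[ g ] Constant g × Reaches k f g
    by-cases (yes const)      k _ = f , const , reaches-refl k f
    by-cases (no nonconstant) k   = descend (goodCount-gap-< connected {f} nonconstant) k

  absorbed⇒constant : Connected G → ∀ {f} → T (inAbsorbingᵇ G f) → Constant f
  absorbed⇒constant connected {f} absorbed = subst Constant (sym f≡g) const
    where
    reached = reaches-constant connected (n ^ n) f (≤-trans (m∸n≤m n (goodCount f)) (n≤n^n n))
    g = proj₁ reached
    const = proj₁ (proj₂ reached)
    back : Reaches (n ^ n) g f
    back = T-not-∨⁻ (All.lookup (all⁺ _ (allVecs n) absorbed) (∈-allVecs n g)) (proj₂ (proj₂ reached))
    f≡g : f ≡ g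
    f≡g = reaches-from-constant (n ^ n) const back

  absorbed-update : Connected G → ∀ {f} v → T (inAbsorbingᵇ G f) → T (inAbsorbingᵇ G (update G f v))
  absorbed-update connected {f} v absorbed =
    subst (T ∘ inAbsorbingᵇ G) (sym (update-constant v (absorbed⇒constant connected {f} absorbed))) absorbed

module TruncSumRecurrence {n : ℕ} (G : Graph n) where

  rounds : ∀ {k} → Valuation n → Vec (Fin n) k → Valuation n
  rounds f []      = f
  rounds f (v ∷ w) = rounds (update G f v) w

  hitTrunc-absorbed : ∀ {k f} → T (inAbsorbingᵇ G f) → (w : Vec (Fin n) k) → hitTrunc G f w ≡ 0
  hitTrunc-absorbed {f = f} absorbed []      = refl
  hitTrunc-absorbed {f = f} absorbed (v ∷ w) with inAbsorbingᵇ G f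
  ... | true  = refl
  ... | false = contradiction absorbed λ ()

  hitTrunc-transient : ∀ {k f} → ¬ T (inAbsorbingᵇ G f) → ∀ v (w : Vec (Fin n) k) →
                       hitTrunc G f (v ∷ w) ≡ suc (hitTrunc G (update G f v) w)
  hitTrunc-transient {f = f} transient v w with inAbsorbingᵇ G f
  ... | true  = contradiction _ transient
  ... | false = refl

  truncSum-absorbed : ∀ k {f} → T (inAbsorbingᵇ G f) → truncSum G k f ≡ 0
  truncSum-absorbed k {f} absorbed = begin
    ∑ (allVecs k) (hitTrunc G f)  ≡⟨ ∑-cong (allVecs k) (hitTrunc-absorbed absorbed) ⟩
    ∑ (allVecs k) (λ _ → 0)       ≡⟨ ∑-const (allVecs k) 0 ⟩
    length (allVecs {n} k) * 0    ≡⟨ *-zeroʳ (length (allVecs {n} k)) ⟩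
    0                             ∎
    where open ≡-Reasoning

  truncSum-transient : ∀ k {f} → ¬ T (inAbsorbingᵇ G f) →
                       truncSum G (suc k) f ≡ ∑ (allFin n) (λ v → n ^ k + truncSum G k (update G f v))
  truncSum-transient k {f} transient = begin
    ∑ (allVecs (suc k)) (hitTrunc G f)                                   ≡⟨ ∑-allVecs-suc k (hitTrunc G f) ⟩
    ∑ (allFin n) (λ v → ∑ (allVecs k) (λ w → hitTrunc G f (v ∷ w)))      ≡⟨ ∑-cong (allFin n) first-round ⟩
    ∑ (allFin n) (λ v → n ^ k + truncSum G k (update G f v))             ∎
    where
    open ≡-Reasoning
    first-round : ∀ v → ∑ (allVecs k) (λ w → hitTrunc G f (v ∷ w)) ≡ n ^ k + truncSum G k (update G f v)
    first-round v = begin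
      ∑ (allVecs k) (λ w → hitTrunc G f (v ∷ w))                               ≡⟨ ∑-cong (allVecs k) (hitTrunc-transient transient v) ⟩
      ∑ (allVecs k) (λ w → 1 + hitTrunc G (update G f v) w)                    ≡⟨ ∑-+ (allVecs k) (λ _ → 1) _ ⟩
      ∑ (allVecs {n} k) (λ _ → 1) + truncSum G k (update G f v)               ≡⟨ cong (_+ truncSum G k (update G f v)) (∑-allVecs-1 k) ⟩
      n ^ k + truncSum G k (update G f v)                                      ∎

module PotentialUpperBound {n : ℕ} (G : Graph n)
  (φ : Valuation n → ℕ) (b : ℕ)
  (φ≤b : ∀ f → φ f ≤ b)
  (φ-mono : ∀ f v → φ f ≤ φ (update G f v))
  (φ-progress : ∀ {f} → ¬ T (inAbsorbingᵇ G f) → ∃[ v ] φ f < φ (update G f v))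
  where

  open TruncSumRecurrence G

  truncSum-≤ : ∀ k f → truncSum G k f ≤ n * (b ∸ φ f) * n ^ k
  truncSum-≤ zero    f = z≤n
  truncSum-≤ (suc k) f with T? (inAbsorbingᵇ G f)
  ... | yes absorbed  rewrite truncSum-absorbed (suc k) absorbed = z≤n
  ... | no  transient = begin
    truncSum G (suc k) f    ≡⟨ truncSum-transient k transient ⟩
    ∑ (allFin n) rest       ≤⟨ +-cancelʳ-≤ (n * P) _ _ sum+slack ⟩
    n * t * (n * P)         ∎
    where
    open ≤-Reasoning
    P = n ^ k
    t = b ∸ φ f
    rest : Fin n → ℕ
    rest v = P + truncSum G k (update G f v)
    absorb-slack : ∀ P n x → P + n * x * P + n * P ≡ P + n * suc x * P
    absorb-slack = solve-∀
    split-slack : ∀ n t P → n * (P + n * t * P) ≡ n * t * (n * P) + n * P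
    split-slack = solve-∀
    v₀ = proj₁ (φ-progress transient)
    gap′<gap : b ∸ φ (update G f v₀) < t
    gap′<gap = ∸-monoʳ-< (proj₂ (φ-progress transient)) (φ≤b (update G f v₀))
    rest≤ : ∀ v → rest v ≤ P + n * t * P
    rest≤ v = +-monoʳ-≤ P (≤-trans (truncSum-≤ k (update G f v))
                (*-monoˡ-≤ P (*-monoʳ-≤ n (∸-monoʳ-≤ b (φ-mono f v)))))
    rest₀+slack≤ : rest v₀ + n * P ≤ P + n * t * P
    rest₀+slack≤ = begin
      P + truncSum G k (update G f v₀) + n * P                 ≤⟨ +-monoˡ-≤ (n * P) (+-monoʳ-≤ P (truncSum-≤ k (update G f v₀))) ⟩
      P + n * (b ∸ φ (update G f v₀)) * P + n * P              ≡⟨ absorb-slack P n (b ∸ φ (update G f v₀)) ⟩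
      P + n * suc (b ∸ φ (update G f v₀)) * P                  ≤⟨ +-monoʳ-≤ P (*-monoˡ-≤ P (*-monoʳ-≤ n gap′<gap)) ⟩
      P + n * t * P                                            ∎
    sum+slack : ∑ (allFin n) rest + n * P ≤ n * t * (n * P) + n * P
    sum+slack = begin
      ∑ (allFin n) rest + n * P            ≤⟨ ∑+slack≤length* (allFin n) rest (∈-allFin v₀) rest≤ rest₀+slack≤ ⟩
      length (allFin n) * (P + n * t * P)  ≡⟨ cong (_* (P + n * t * P)) (length-allFin n) ⟩
      n * (P + n * t * P)                  ≡⟨ split-slack n t P ⟩
      n * t * (n * P) + n * P              ∎

module PotentialLowerBound {n : ℕ} (G : Graph n)
  (Φ : Valuation n → ℕ) (Φmax : ℕ)
  (Φ≤Φmax : ∀ f → Φ f ≤ Φmax)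
  (Φ-absorbed : ∀ {f} → T (inAbsorbingᵇ G f) → Φ f ≡ 0)
  (absorbed-closed : ∀ {f} v → T (inAbsorbingᵇ G f) → T (inAbsorbingᵇ G (update G f v)))
  (Φ-drift : ∀ f → n * Φ f ≤ n + ∑ (allFin n) (λ v → Φ (update G f v)))
  where

  open TruncSumRecurrence G

  residual : ℕ → Valuation n → ℕ
  residual k f = ∑ (allVecs k) (λ w → Φ (rounds f w))

  Φ-rounds-absorbed : ∀ {k f} → T (inAbsorbingᵇ G f) → (w : Vec (Fin n) k) → Φ (rounds f w) ≡ 0
  Φ-rounds-absorbed absorbed []      = Φ-absorbed absorbed
  Φ-rounds-absorbed absorbed (v ∷ w) = Φ-rounds-absorbed (absorbed-closed v absorbed) w

  potential≤truncSum+residual : ∀ k f → n ^ k * Φ f ≤ truncSum G k f + residual k f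
  potential≤truncSum+residual zero    f = ≤-reflexive (trans (+-identityʳ (Φ f)) (sym (+-identityʳ (Φ f))))
  potential≤truncSum+residual (suc k) f with T? (inAbsorbingᵇ G f)
  ... | yes absorbed  rewrite Φ-absorbed absorbed | *-zeroʳ (n ^ suc k) = z≤n
  ... | no  transient = begin
    n * P * Φ f                                                  ≡⟨ xy∙z≈y∙xz *-commutativeSemigroup n P (Φ f) ⟩
    P * (n * Φ f)                                                ≤⟨ *-monoʳ-≤ P (Φ-drift f) ⟩
    P * (n + ∑ (allFin n) (λ v → Φ (f′ v)))                      ≡⟨ *-distribˡ-+ P n _ ⟩
    P * n + P * ∑ (allFin n) (λ v → Φ (f′ v))                    ≡⟨ cong₂ _+_ (sym ∑P) (sym (∑-*ˡ (allFin n) P _)) ⟩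
    ∑ (allFin n) (λ _ → P) + ∑ (allFin n) (λ v → P * Φ (f′ v))   ≡⟨ ∑-+ (allFin n) _ _ ⟨
    ∑ (allFin n) (λ v → P + P * Φ (f′ v))                        ≤⟨ ∑-mono-≤ (allFin n) (λ v → +-monoʳ-≤ P (potential≤truncSum+residual k (f′ v))) ⟩
    ∑ (allFin n) (λ v → P + (truncSum G k (f′ v) + residual k (f′ v)))
                                                                 ≡⟨ ∑-cong (allFin n) (λ v → +-assoc P _ _) ⟨
    ∑ (allFin n) (λ v → P + truncSum G k (f′ v) + residual k (f′ v))
                                                                 ≡⟨ ∑-+ (allFin n) _ _ ⟩
    ∑ (allFin n) (λ v → P + truncSum G k (f′ v)) + ∑ (allFin n) (λ v → residual k (f′ v))
                                                                 ≡⟨ cong₂ _+_ (truncSum-transient k transient) (∑-allVecs-suc {n} k (λ w → Φ (rounds f w))) ⟨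
    truncSum G (suc k) f + residual (suc k) f                    ∎
    where
    open ≤-Reasoning
    P = n ^ k
    f′ : Fin n → Valuation n
    f′ = update G f
    ∑P : ∑ (allFin n) (λ _ → P) ≡ P * n
    ∑P = trans (∑-const (allFin n) P) (trans (cong (_* P) (length-allFin n)) (*-comm n P))

  Φ-rounds≤ : ∀ {k} f (w : Vec (Fin n) k) → k * Φ (rounds f w) ≤ Φmax * hitTrunc G f w
  Φ-rounds≤ f []      = z≤n
  Φ-rounds≤ {suc k} f (v ∷ w) with T? (inAbsorbingᵇ G f)
  ... | yes absorbed
    rewrite Φ-rounds-absorbed absorbed (v ∷ w) | hitTrunc-absorbed absorbed (v ∷ w) | *-zeroʳ k | *-zeroʳ Φmax = z≤n
  ... | no  transient rewrite hitTrunc-transient transient v w = begin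
    Φ (rounds f′ w) + k * Φ (rounds f′ w)   ≤⟨ +-mono-≤ (Φ≤Φmax (rounds f′ w)) (Φ-rounds≤ f′ w) ⟩
    Φmax + Φmax * hitTrunc G f′ w           ≡⟨ *-suc Φmax (hitTrunc G f′ w) ⟨
    Φmax * suc (hitTrunc G f′ w)            ∎
    where
    open ≤-Reasoning
    f′ = update G f v

  residual≤ : ∀ k f → k * residual k f ≤ Φmax * truncSum G k f
  residual≤ k f = begin
    k * residual k f                                ≡⟨ ∑-*ˡ (allVecs k) k _ ⟨
    ∑ (allVecs k) (λ w → k * Φ (rounds f w))        ≤⟨ ∑-mono-≤ (allVecs k) (Φ-rounds≤ f) ⟩
    ∑ (allVecs k) (λ w → Φmax * hitTrunc G f w)     ≡⟨ ∑-*ˡ (allVecs k) Φmax _ ⟩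
    Φmax * truncSum G k f                           ∎
    where open ≤-Reasoning

  truncSum-≥ : ∀ f → n ^ suc Φmax * Φ f ≤ 2 * truncSum G (suc Φmax) f
  truncSum-≥ f = *-cancelˡ-≤ k (begin
    k * (n ^ k * Φ f)           ≤⟨ *-monoʳ-≤ k (potential≤truncSum+residual k f) ⟩
    k * (Tk + residual k f)     ≡⟨ *-distribˡ-+ k Tk _ ⟩
    k * Tk + k * residual k f   ≤⟨ +-monoʳ-≤ (k * Tk) (residual≤ k f) ⟩
    k * Tk + Φmax * Tk          ≤⟨ +-monoʳ-≤ (k * Tk) (*-monoˡ-≤ Tk (n≤1+n Φmax)) ⟩
    k * Tk + k * Tk             ≡⟨ double k Tk ⟩
    k * (2 * Tk)                ∎)
    where
    open ≤-Reasoning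
    k = suc Φmax
    Tk = truncSum G k f
    double : ∀ k t → k * t + k * t ≡ k * (2 * t)
    double = solve-∀

floorHarmonic : ℕ → ℕ → ℕ
floorHarmonic n zero                = 0
floorHarmonic n (suc zero)          = 0
floorHarmonic n (suc q@(suc _))     = floorHarmonic n q + n / suc q

module _ (n : ℕ) where

  floorHarmonic-≤1 : ∀ {q} → q ≤ 1 → floorHarmonic n q ≡ 0
  floorHarmonic-≤1 z≤n       = refl
  floorHarmonic-≤1 (s≤s z≤n) = refl

  floorHarmonic-suc : ∀ q → floorHarmonic n q ≤ floorHarmonic n (suc q)
  floorHarmonic-suc zero    = z≤n
  floorHarmonic-suc (suc q) = m≤m+n (floorHarmonic n (suc q)) _

  floorHarmonic-mono : ∀ {q r} → q ≤ r → floorHarmonic n q ≤ floorHarmonic n r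
  floorHarmonic-mono q≤r = go (≤⇒≤′ q≤r)
    where
    go : ∀ {q r} → q ≤′ r → floorHarmonic n q ≤ floorHarmonic n r
    go ≤′-refl         = ≤-refl
    go {r = suc r} (≤′-step q≤′r) = ≤-trans (go q≤′r) (floorHarmonic-suc r)

  floorHarmonic-pred : ∀ q → q * floorHarmonic n q ≤ q * floorHarmonic n (q ∸ 1) + n
  floorHarmonic-pred zero          = z≤n
  floorHarmonic-pred (suc zero)    = z≤n
  floorHarmonic-pred q@(suc (suc m)) = begin
    q * (floorHarmonic n (suc m) + n / q)   ≡⟨ *-distribˡ-+ q (floorHarmonic n (suc m)) (n / q) ⟩
    q * floorHarmonic n (suc m) + q * (n / q) ≤⟨ +-monoʳ-≤ _ (≤-trans (≤-reflexive (*-comm q (n / q))) (m/n*n≤m n q)) ⟩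
    q * floorHarmonic n (suc m) + n          ∎
    where open ≤-Reasoning

  floorHarmonic-block : ∀ a b → floorHarmonic n (suc a) + b * (n / (suc a + b)) ≤ floorHarmonic n (suc a + b)
  floorHarmonic-block a zero    = ≤-reflexive (trans (+-identityʳ _) (cong (floorHarmonic n) (sym (+-identityʳ (suc a)))))
  floorHarmonic-block a (suc b) rewrite +-suc a b = begin
    floorHarmonic n (suc a) + (n / d + b * (n / d))          ≡⟨ move-last (floorHarmonic n (suc a)) (n / d) b ⟩
    floorHarmonic n (suc a) + b * (n / d) + n / d            ≤⟨ +-monoˡ-≤ (n / d) (+-monoʳ-≤ _ (*-monoʳ-≤ b (/-monoʳ-≤ n (n≤1+n (suc a + b))))) ⟩
    floorHarmonic n (suc a) + b * (n / (suc a + b)) + n / d  ≤⟨ +-monoˡ-≤ (n / d) (floorHarmonic-block a b) ⟩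
    floorHarmonic n (suc a + b) + n / d                      ∎
    where
    open ≤-Reasoning
    d = suc (suc (a + b))
    move-last : ∀ h x b → h + (x + b * x) ≡ h + b * x + x
    move-last = solve-∀

  n≤4*[p*[n/2p]] : ∀ a → let p = suc a in 2 * p ≤ n → n ≤ 4 * (p * (n / (2 * p)))
  n≤4*[p*[n/2p]] a 2p≤n = begin
    n                           ≡⟨ m≡m%n+[m/n]*n n d ⟩
    n % d + q * d               ≤⟨ +-monoˡ-≤ (q * d) (<⇒≤ (m%n<n n d)) ⟩
    d + q * d                   ≡⟨ cong (_+ q * d) (*-identityˡ d) ⟨
    1 * d + q * d               ≤⟨ +-monoˡ-≤ (q * d) (*-monoˡ-≤ d (m≥n⇒m/n>0 2p≤n)) ⟩
    q * d + q * d               ≡⟨ regroup p q ⟩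
    4 * (p * q)                 ∎
    where
    open ≤-Reasoning
    p = suc a
    d = 2 * p
    q = n / d
    regroup : ∀ p q → q * (2 * p) + q * (2 * p) ≡ 4 * (p * q)
    regroup = solve-∀

  floorHarmonic-doubling : ∀ p → 1 ≤ p → 2 * p ≤ n → 4 * floorHarmonic n p + n ≤ 4 * floorHarmonic n (2 * p)
  floorHarmonic-doubling p@(suc a) 1≤p 2p≤n = begin
    4 * floorHarmonic n p + n                         ≤⟨ +-monoʳ-≤ _ (n≤4*[p*[n/2p]] a 2p≤n) ⟩
    4 * floorHarmonic n p + 4 * (p * (n / (2 * p)))   ≡⟨ *-distribˡ-+ 4 (floorHarmonic n p) _ ⟨
    4 * (floorHarmonic n p + p * (n / (2 * p)))       ≤⟨ *-monoʳ-≤ 4 block ⟩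
    4 * floorHarmonic n (2 * p)                       ∎
    where
    open ≤-Reasoning
    block : floorHarmonic n p + p * (n / (2 * p)) ≤ floorHarmonic n (2 * p)
    block = subst (λ b → floorHarmonic n p + b * (n / (2 * p)) ≤ floorHarmonic n (2 * p))
                  (+-identityʳ p) (floorHarmonic-block a (p + 0))

  i*n≤4*floorHarmonic[2^i] : ∀ i → 2 ^ i ≤ n → i * n ≤ 4 * floorHarmonic n (2 ^ i)
  i*n≤4*floorHarmonic[2^i] zero    _        = z≤n
  i*n≤4*floorHarmonic[2^i] (suc i) 2^1+i≤n = begin
    n + i * n                          ≤⟨ +-monoʳ-≤ n (i*n≤4*floorHarmonic[2^i] i (≤-trans (m≤m+n (2 ^ i) _) 2^1+i≤n)) ⟩
    n + 4 * floorHarmonic n (2 ^ i)    ≡⟨ +-comm n _ ⟩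
    4 * floorHarmonic n (2 ^ i) + n    ≤⟨ floorHarmonic-doubling (2 ^ i) (m^n>0 2 i) 2^1+i≤n ⟩
    4 * floorHarmonic n (2 ^ suc i)    ∎
    where open ≤-Reasoning

2^⌊log₂n⌋≤n : ∀ n → 1 ≤ n → 2 ^ ⌊log₂ n ⌋ ≤ n
2^⌊log₂n⌋≤n n = go n (<-wellFounded n)
  where
  2*⌊n/2⌋≤n : ∀ m → 2 * ⌊ m /2⌋ ≤ m
  2*⌊n/2⌋≤n m = begin
    ⌊ m /2⌋ + (⌊ m /2⌋ + 0)   ≡⟨ cong (⌊ m /2⌋ +_) (+-identityʳ _) ⟩
    ⌊ m /2⌋ + ⌊ m /2⌋         ≤⟨ +-monoʳ-≤ ⌊ m /2⌋ (⌊n/2⌋≤⌈n/2⌉ m) ⟩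
    ⌊ m /2⌋ + ⌈ m /2⌉         ≡⟨ ⌊n/2⌋+⌈n/2⌉≡n m ⟩
    m                         ∎
    where open ≤-Reasoning
  go : ∀ m (rec : Acc _<_ m) → 1 ≤ m → 2 ^ ⌊log2⌋ m rec ≤ m
  go (suc zero)    _         _ = ≤-refl
  go (suc (suc m)) (acc rec) _ = begin
    2 * 2 ^ ⌊log2⌋ (suc ⌊ m /2⌋) _   ≤⟨ *-monoʳ-≤ 2 (go (suc ⌊ m /2⌋) _ (s≤s z≤n)) ⟩
    2 * suc ⌊ m /2⌋                  ≡⟨ *-suc 2 ⌊ m /2⌋ ⟩
    2 + 2 * ⌊ m /2⌋                  ≤⟨ +-monoʳ-≤ 2 (2*⌊n/2⌋≤n m) ⟩
    2 + m                            ∎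
    where open ≤-Reasoning

⌊log₂n⌋*n≤4*floorHarmonic : ∀ n → ⌊log₂ n ⌋ * n ≤ 4 * floorHarmonic n n
⌊log₂n⌋*n≤4*floorHarmonic zero      = z≤n
⌊log₂n⌋*n≤4*floorHarmonic n@(suc _) = begin
  ⌊log₂ n ⌋ * n                           ≤⟨ i*n≤4*floorHarmonic[2^i] n ⌊log₂ n ⌋ 2^log≤n ⟩
  4 * floorHarmonic n (2 ^ ⌊log₂ n ⌋)     ≤⟨ *-monoʳ-≤ 4 (floorHarmonic-mono n 2^log≤n) ⟩
  4 * floorHarmonic n n                   ∎
  where
  open ≤-Reasoning
  2^log≤n : 2 ^ ⌊log₂ n ⌋ ≤ n
  2^log≤n = 2^⌊log₂n⌋≤n n (s≤s z≤n)

module Convergence {n : ℕ} (G : Graph n) (connected : Connected G) where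

  open MaxModel G
  open Absorption G

  potential : Valuation n → ℕ
  potential f = floorHarmonic n (fixedCount f)

  potential-update : ∀ f x → let h = floorHarmonic n; q = fixedCount f; d = Fixed? f x in
                     h q + ind d * h (q ∸ 1) ≤ potential (update G f x) + ind d * h q
  potential-update f x = by-cases (Fixed? f x)
    where
    h = floorHarmonic n
    q = fixedCount f
    by-cases : (d : Dec (lookup f x ≡ x)) → h q + ind d * h (q ∸ 1) ≤ potential (update G f x) + ind d * h q
    by-cases (no fx≢x) = +-monoˡ-≤ 0 (floorHarmonic-mono n (fixedCount-update-unfixed f x fx≢x))
    by-cases (yes _)   = begin
      h q + 1 * h (q ∸ 1)                  ≡⟨ +-comm (h q) (1 * h (q ∸ 1)) ⟩
      1 * h (q ∸ 1) + h q                  ≡⟨ cong₂ _+_ (*-identityˡ (h (q ∸ 1))) (sym (*-identityˡ (h q))) ⟩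
      h (q ∸ 1) + 1 * h q                  ≤⟨ +-monoˡ-≤ (1 * h q) (floorHarmonic-mono n q∸1≤q′) ⟩
      potential (update G f x) + 1 * h q   ∎
      where
      open ≤-Reasoning
      q∸1≤q′ : q ∸ 1 ≤ fixedCount (update G f x)
      q∸1≤q′ = ≤-trans (∸-monoˡ-≤ 1 (fixedCount-update f x)) (≤-reflexive (m+n∸n≡m _ 1))

  potential-drift : ∀ f → n * potential f ≤ n + ∑ (allFin n) (λ v → potential (update G f v))
  potential-drift f = +-cancelʳ-≤ (q * h (q ∸ 1)) _ _ (begin
    n * h q + q * h (q ∸ 1)                                       ≡⟨ cong₂ _+_ ∑-hq (∑-*ʳ (allFin n) (h (q ∸ 1)) fixed) ⟨
    ∑ (allFin n) (λ _ → h q) + ∑ (allFin n) (λ x → fixed x * h (q ∸ 1))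
                                                                  ≡⟨ ∑-+ (allFin n) _ _ ⟨
    ∑ (allFin n) (λ x → h q + fixed x * h (q ∸ 1))                ≤⟨ ∑-mono-≤ (allFin n) (potential-update f) ⟩
    ∑ (allFin n) (λ x → potential (update G f x) + fixed x * h q) ≡⟨ ∑-+ (allFin n) _ _ ⟩
    S + ∑ (allFin n) (λ x → fixed x * h q)                        ≡⟨ cong (S +_) (∑-*ʳ (allFin n) (h q) fixed) ⟩
    S + q * h q                                                   ≤⟨ +-monoʳ-≤ S (floorHarmonic-pred n q) ⟩
    S + (q * h (q ∸ 1) + n)                                       ≡⟨ rotate S (q * h (q ∸ 1)) n ⟩
    n + S + q * h (q ∸ 1)                                         ∎)
    where
    open ≤-Reasoning
    h = floorHarmonic n
    q = fixedCount f
    S = ∑ (allFin n) (λ v → potential (update G f v))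
    fixed : Fin n → ℕ
    fixed x = ind (Fixed? f x)
    rotate : ∀ a b c → a + (b + c) ≡ c + a + b
    rotate = solve-∀
    ∑-hq : ∑ (allFin n) (λ _ → h q) ≡ n * h q
    ∑-hq = trans (∑-const (allFin n) (h q)) (cong (_* h q) (length-allFin n))

  identity : Valuation n
  identity = Vec.allFin n

  horizon : ℕ
  horizon = suc (floorHarmonic n n)

  truncSum-identity : n ^ horizon * floorHarmonic n n ≤ 2 * truncSum G horizon identity
  truncSum-identity = subst (λ q → n ^ horizon * floorHarmonic n q ≤ 2 * truncSum G horizon identity)
                        fixedCount-identity (truncSum-≥ identity)
    where
    open PotentialLowerBound G potential (floorHarmonic n n)
           (λ f → floorHarmonic-mono n (fixedCount-≤ f))
           (λ {f} absorbed → floorHarmonic-≤1 n (fixedCount-constant {f} (absorbed⇒constant connected {f} absorbed)))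
           (absorbed-update connected)
           potential-drift

  lower-bound : n * ⌊log₂ n ⌋ * n ^ horizon ≤ 8 * truncSum G horizon identity
  lower-bound = begin
    n * ⌊log₂ n ⌋ * P                 ≡⟨ cong (_* P) (*-comm n ⌊log₂ n ⌋) ⟩
    ⌊log₂ n ⌋ * n * P                 ≤⟨ *-monoˡ-≤ P (⌊log₂n⌋*n≤4*floorHarmonic n) ⟩
    4 * H * P                         ≡⟨ trans (*-assoc 4 H P) (cong (4 *_) (*-comm H P)) ⟩
    4 * (P * H)                       ≤⟨ *-monoʳ-≤ 4 truncSum-identity ⟩
    4 * (2 * truncSum G horizon identity) ≡⟨ *-assoc 4 2 (truncSum G horizon identity) ⟨
    8 * truncSum G horizon identity   ∎
    where
    open ≤-Reasoning
    P = n ^ horizon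
    H = floorHarmonic n n

  upper-bound : ∀ f k → truncSum G k f ≤ 1 * n ^ 2 * n ^ k
  upper-bound f k = begin
    truncSum G k f                  ≤⟨ truncSum-≤ k f ⟩
    n * (n ∸ goodCount f) * n ^ k   ≤⟨ *-monoˡ-≤ (n ^ k) (*-monoʳ-≤ n (m∸n≤m n (goodCount f))) ⟩
    n * n * n ^ k                   ≡⟨ cong (_* n ^ k) n*n≡1*n^2 ⟩
    1 * n ^ 2 * n ^ k               ∎
    where
    open ≤-Reasoning
    open PotentialUpperBound G goodCount n goodCount-≤ goodCount-mono
           (λ {f} transient → goodCount-progress connected {f} (transient ∘ constant⇒absorbed {f}))
    n*n≡1*n^2 : n * n ≡ 1 * n ^ 2
    n*n≡1*n^2 = sym (trans (*-identityˡ (n ^ 2)) (cong (n *_) (*-identityʳ n)))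

mainTheorem1 : ∃[ a ] ∃[ C ] ∃[ N ] (1 ≤ a × 1 ≤ C ×
    ((n : ℕ) → N ≤ n → (G : Graph n) → Connected G →
    (∃[ f ] ∃[ k ] (n * ⌊log₂ n ⌋ * n ^ k ≤ a * truncSum G k f))
    × ((f : Valuation n) (k : ℕ) → truncSum G k f ≤ C * n ^ 2 * n ^ k)))
-- Both bounds hold for every n, so no threshold is needed.
mainTheorem1 = 8 , 1 , 0 , s≤s z≤n , s≤s z≤n , λ n _ G connected →
  let open Convergence G connected in (identity , horizon , lower-bound) , upper-bound
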